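{- Let $F$ be an $(r+1)$-colorable graph having a proper $(r+1)$-coloring in which one color class has order $s$ and another color class has order $t$. Let $G$ be a graph whose vertex set is partitioned as $V(G)=A_1\cup\dots\cup A_r$ with $|A_i|\ge |V(F)|^2$ for every $i$. Assume that for all $i\neq j$, each vertex of $A_i$ is adjacent to all but at most $|A_j|/|V(F)|$ vertices of $A_j$. If for some $i$ the induced subgraph $G[A_i]$ contains a copy of $K_{s,t}$, then $G$ contains a copy of $F$.
   Context: $K_{s,t}$ denotes the complete bipartite graph with parts of orders $s$ and $t$. A copy of a graph means a subgraph isomorphic to it. -}

module Defs where

open import Data.Nat using (ℕ; _+_; _*_; _^_; _≤_)
open import Data.Bool using (Bool; true; false; T)
import Data.Bool.Properties as BoolP
open import Data.Fin using (Fin; splitAt)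
import Data.Fin.Properties as FinP
open import Data.List using (List; length; filter)
open import Data.List.Base using () renaming (allFin to allFinL)
open import Data.Sum using (inj₁; inj₂)
open import Data.Product using (Σ; ∃; ∃-syntax; _×_; _,_)
open import Relation.Binary.PropositionalEquality using (_≡_; _≢_)
open import Relation.Unary using (Pred; Decidable)
open import Relation.Nullary.Decidable using (_×-dec_)
open import Function.Definitions using (Injective)
open import Level using (0ℓ)

record Graph (n : ℕ) : Set where
  field
    adj    : Fin n → Fin n → Bool
    sym    : ∀ u v → adj u v ≡ adj v u
    irrefl : ∀ u → adj u u ≡ false
open Graph public

Edge : ∀ {n} → Graph n → Fin n → Fin n → Set
Edge G u v = T (adj G u v)

count : ∀ {n} {P : Pred (Fin n) 0ℓ} → Decidable P → ℕ
count {n} P? = length (filter P? (allFinL n))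

IsEmbedding : ∀ {m n} → Graph m → Graph n → (Fin m → Fin n) → Set
IsEmbedding {m} F G φ = Injective _≡_ _≡_ φ × (∀ u v → Edge F u v → Edge G (φ u) (φ v))

ContainsCopy : ∀ {m n} → Graph m → Graph n → Set
ContainsCopy {m} {n} F G = Σ (Fin m → Fin n) λ φ → IsEmbedding F G φ

-- Complete bipartite graph K_{s,t} on Fin (s + t): first s vertices vs last t.
sideOf : ∀ s {t} → Fin (s + t) → Bool
sideOf s x with splitAt s x
... | inj₁ _ = true
... | inj₂ _ = false

K : (s t : ℕ) → Graph (s + t)
K s t = record
  { adj = λ u v → sideOf s u Data.Bool.xor sideOf s v
  ; sym = λ u v → BoolP.xor-comm (sideOf s u) (sideOf s v)
  ; irrefl = λ u → BoolP.xor-same (sideOf s u)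
  }

IsProperColoring : ∀ {m} → Graph m → (k : ℕ) → (Fin m → Fin k) → Set
IsProperColoring F k c = ∀ u v → Edge F u v → c u ≢ c v

classSize : ∀ {m k} → (Fin m → Fin k) → Fin k → ℕ
classSize c a = count (λ v → c v FinP.≟ a)

partSize : ∀ {n r} → (Fin n → Fin r) → Fin r → ℕ
partSize part i = count (λ w → part w FinP.≟ i)

nonNbrsIn : ∀ {n r} → Graph n → (Fin n → Fin r) → Fin n → Fin r → ℕ
nonNbrsIn G part v j = count (λ w → (part w FinP.≟ j) ×-dec (adj G v w BoolP.≟ false))

-- G[A_i] contains a copy of H: an embedding of H into G with image inside A_i
InducedPartContainsCopy : ∀ {m n r} → Graph m → Graph n → (Fin n → Fin r) → Fin r → Set
InducedPartContainsCopy H G part i =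
  Σ _ λ φ → IsEmbedding H G φ × (∀ x → part (φ x) ≡ i)

{-# OPTIONS --safe #-}
-- Colour classes a and b go onto the two sides of the given K_{s,t} in A_i, and every other colour
-- class to a part of its own, via a map from the r + 1 colours onto the r parts that identifies only
-- a and b.  The remaining vertices of F are then placed greedily, one at a time.  A vertex w bound
-- for A_j has to avoid, for every other vertex u, the vertices of A_j excluded by the image z of u:
-- z itself if z lies in A_j, and the non-neighbours of z in A_j otherwise.  Each of these m − 1 sets
-- has at most |A_j| / m elements (for the singletons because |A_j| ≥ m²), so they cannot cover A_j.
-- Since the colouring is proper, no neighbour of w is bound for A_j, so the chosen vertex is adjacent
-- to the images of all neighbours of w placed so far.
module Submission where

open import Defs hiding (sym)
open import Data.Bool using (Bool; true; false; T; not; _∧_; _xor_; if_then_else_)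
open import Data.Bool.Properties using (T-∧; T-not-≡) renaming (_≟_ to _≟ᵇ_)
open import Data.Empty using (⊥-elim)
open import Data.Fin using (Fin; zero; suc; toℕ; fromℕ<; punchIn; punchOut; _↑ˡ_; _↑ʳ_)
open import Data.Fin.Properties
  using (_≟_; punchInᵢ≢i; punchIn-punchOut; punchOut-cong; punchOut-injective; fromℕ<-injective;
         ↑ˡ-injective; ↑ʳ-injective; toℕ-injective; toℕ-fromℕ<; toℕ<n; splitAt-↑ˡ; splitAt-↑ʳ)
import Data.Fin.Permutation.Components as Perm
open import Data.List using (length; filter; tabulate)
open import Data.Nat using (ℕ; zero; suc; _+_; _*_; _^_; _≤_; _<_; _<ᵇ_; z≤n; s≤s; >-nonZero; >-nonZero⁻¹)
open import Data.Nat.Properties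
  using (≤-refl; ≤-trans; <-trans; <-irrefl; <-cmp; <⇒≤; <ᵇ⇒<; <⇒<ᵇ; m≤n⇒m≤1+n; m<n⇒m<1+n;
         m≤n⇒m<n∨m≡n; m≤m*n; m<n+m; m*n≢0⇒m≢0; +-suc; +-monoˡ-≤; +-cancelˡ-<; *-comm; *-suc;
         *-identityˡ; *-monoˡ-≤; *-distribʳ-+; module ≤-Reasoning)
open import Data.Product using (Σ; ∃; _×_; _,_; proj₁; proj₂)
open import Data.Sum using (_⊎_; inj₁; inj₂; [_,_])
open import Data.Vec.Functional using (updateAt)
open import Data.Vec.Functional.Properties using (updateAt-updates; updateAt-minimal)
open import Function using (_∘_; id; const; _$_)
open import Function.Bundles using (Equivalence; _⇔_; mk⇔)
open import Level using (0ℓ)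
open import Relation.Binary using (tri<; tri≈; tri>)
open import Relation.Binary.PropositionalEquality hiding ([_])
open import Relation.Nullary using (Dec; yes; no; does; ¬_)
open import Relation.Nullary.Decidable using (dec-true; _×-dec_)
open import Relation.Unary using (Pred; Decidable; _⊆_; _∪_; ｛_｝)

open Equivalence using (to; from)

T-does : ∀ {A : Set} (a? : Dec A) → T (does a?) ⇔ A
T-does (yes a)  = mk⇔ (const a) (const _)
T-does (no ¬a) = mk⇔ (λ ()) ¬a

countᵇ : ∀ {n} → (Fin n → Bool) → ℕ
countᵇ {zero}  p = 0
countᵇ {suc n} p = if p zero then suc (countᵇ (p ∘ suc)) else countᵇ (p ∘ suc)

count-tabulate : ∀ {A : Set} {k} {P : Pred A 0ℓ} (P? : Decidable P) (f : Fin k → A) →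
  length (filter P? (tabulate f)) ≡ countᵇ (does ∘ P? ∘ f)
count-tabulate {k = zero}  P? f = refl
count-tabulate {k = suc k} P? f with does (P? (f zero))
... | true  = cong suc (count-tabulate P? (f ∘ suc))
... | false = count-tabulate P? (f ∘ suc)

count≡countᵇ : ∀ {n} {P : Pred (Fin n) 0ℓ} (P? : Decidable P) → count P? ≡ countᵇ (does ∘ P?)
count≡countᵇ P? = count-tabulate P? id

countᵇ-false : ∀ n → countᵇ {n} (λ _ → false) ≡ 0
countᵇ-false zero    = refl
countᵇ-false (suc n) = countᵇ-false n

countᵇ-mono : ∀ {n} {p q : Fin n → Bool} → (∀ x → T (p x) → T (q x)) → countᵇ p ≤ countᵇ q
countᵇ-mono {zero}          p⊆q = z≤n
countᵇ-mono {suc n} {p} {q} p⊆q with p zero | q zero | p⊆q zero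
... | true  | true  | _   = s≤s (countᵇ-mono (p⊆q ∘ suc))
... | true  | false | p⊈q = ⊥-elim (p⊈q _)
... | false | true  | _   = m≤n⇒m≤1+n (countᵇ-mono (p⊆q ∘ suc))
... | false | false | _   = countᵇ-mono (p⊆q ∘ suc)

countᵇ-< : ∀ {n} {p q : Fin n → Bool} → (∀ x → T (p x) → T (q x)) →
  ∀ y → ¬ T (p y) → T (q y) → countᵇ p < countᵇ q
countᵇ-< {suc n} {p} {q} p⊆q zero ¬py qy with p zero | q zero
... | true  | _     = ⊥-elim (¬py _)
... | false | true  = s≤s (countᵇ-mono (p⊆q ∘ suc))
countᵇ-< {suc n} {p} {q} p⊆q (suc y) ¬py qy with p zero | q zero | p⊆q zero
... | true  | true  | _   = s≤s (countᵇ-< (p⊆q ∘ suc) y ¬py qy)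
... | true  | false | p⊈q = ⊥-elim (p⊈q _)
... | false | true  | _   = m<n⇒m<1+n (countᵇ-< (p⊆q ∘ suc) y ¬py qy)
... | false | false | _   = countᵇ-< (p⊆q ∘ suc) y ¬py qy

countᵇ-split : ∀ {n} (p q : Fin n → Bool) →
  countᵇ p ≡ countᵇ (λ x → p x ∧ q x) + countᵇ (λ x → p x ∧ not (q x))
countᵇ-split {zero}  p q = refl
countᵇ-split {suc n} p q with p zero | q zero
... | true  | true  = cong suc (countᵇ-split (p ∘ suc) (q ∘ suc))
... | true  | false = trans (cong suc (countᵇ-split (p ∘ suc) (q ∘ suc))) (sym (+-suc _ _))
... | false | _     = countᵇ-split (p ∘ suc) (q ∘ suc)

countᵇ-≟ : ∀ {n} (z : Fin n) → countᵇ (λ x → does (x ≟ z)) ≡ 1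
countᵇ-≟ {suc n} zero    = cong suc (countᵇ-false n)
countᵇ-≟ {suc n} (suc z) = countᵇ-≟ z

countᵇ>0⇒∃ : ∀ {n} (p : Fin n → Bool) → 0 < countᵇ p → ∃ λ x → T (p x)
countᵇ>0⇒∃ {suc n} p pos with p zero in pzero
... | true  = zero , subst T (sym pzero) _
... | false = let x , px = countᵇ>0⇒∃ (p ∘ suc) pos in suc x , px

uncovered : ∀ {k n} (A : Fin n → Bool) (B : Fin k → Fin n → Bool) {M C : ℕ} →
  (∀ u → countᵇ (λ x → A x ∧ B u x) * M ≤ C) → k * C < countᵇ A * M →
  ∃ λ x → T (A x) × (∀ u → ¬ T (B u x))
uncovered {zero} A B _ |A|M>0 =
  let x , Ax = countᵇ>0⇒∃ A (>-nonZero⁻¹ _ {{m*n≢0⇒m≢0 _ {{>-nonZero |A|M>0}}}}) in x , Ax , λ ()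
uncovered {suc k} A B {M} {C} small large =
  let x , A′x , free = uncovered A′ (B ∘ suc) small′ large′
      Ax , ¬B₀x = to (T-∧ {A x}) A′x
  in x , Ax , λ { zero B₀x → subst T (to T-not-≡ ¬B₀x) B₀x ; (suc u) → free u }
  where
    A′ : Fin _ → Bool
    A′ x = A x ∧ not (B zero x)

    small′ : ∀ u → countᵇ (λ x → A′ x ∧ B (suc u) x) * M ≤ C
    small′ u = ≤-trans (*-monoˡ-≤ M (countᵇ-mono dropNotB₀)) (small (suc u))
      where
        dropNotB₀ : ∀ x → T (A′ x ∧ B (suc u) x) → T (A x ∧ B (suc u) x)
        dropNotB₀ x h = let A′x , Bx = to (T-∧ {A′ x}) h in from T-∧ (proj₁ (to (T-∧ {A x}) A′x) , Bx)

    large′ : k * C < countᵇ A′ * M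
    large′ = +-cancelˡ-< C _ _ $ begin-strict
      C + k * C                                                   <⟨ large ⟩
      countᵇ A * M                                                ≡⟨ cong (_* M) (countᵇ-split A (B zero)) ⟩
      (countᵇ (λ x → A x ∧ B zero x) + countᵇ A′) * M            ≡⟨ *-distribʳ-+ M (countᵇ (λ x → A x ∧ B zero x)) _ ⟩
      countᵇ (λ x → A x ∧ B zero x) * M + countᵇ A′ * M           ≤⟨ +-monoˡ-≤ _ (small zero) ⟩
      C + countᵇ A′ * M                                           ∎
      where open ≤-Reasoning

uncoveredExcept : ∀ {k n} (A : Fin n → Bool) (B : Fin k → Fin n → Bool) (w : Fin k) →
  0 < countᵇ A → (∀ u → u ≢ w → countᵇ (λ x → A x ∧ B u x) * k ≤ countᵇ A) →
  ∃ λ x → T (A x) × (∀ u → u ≢ w → ¬ T (B u x))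
uncoveredExcept {suc k} A B w |A|>0 small =
  let x , Ax , free = uncovered A (B ∘ punchIn w) (λ v → small (punchIn w v) (punchInᵢ≢i w v)) k|A|<|A|[1+k]
  in x , Ax , λ u u≢w → subst (λ u → ¬ T (B u x)) (punchIn-punchOut (u≢w ∘ sym)) (free _)
  where
    open ≤-Reasoning
    k|A|<|A|[1+k] : k * countᵇ A < countᵇ A * suc k
    k|A|<|A|[1+k] = begin-strict
      k * countᵇ A               ≡⟨ *-comm k _ ⟩
      countᵇ A * k               <⟨ m<n+m _ |A|>0 ⟩
      countᵇ A + countᵇ A * k    ≡⟨ *-suc (countᵇ A) k ⟨
      countᵇ A * suc k           ∎

module _ {n} {P : Pred (Fin n) 0ℓ} (P? : Decidable P) where

  rank : Fin n → ℕ
  rank u = countᵇ (λ v → does (P? v) ∧ (toℕ v <ᵇ toℕ u))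

  private
    ¬u<u : ∀ u → ¬ T (does (P? u) ∧ (toℕ u <ᵇ toℕ u))
    ¬u<u u h = <-irrefl refl (<ᵇ⇒< (toℕ u) (toℕ u) (proj₂ (to (T-∧ {does (P? u)}) h)))

  rank<count : ∀ {u} → P u → rank u < count P?
  rank<count {u} Pu = subst (rank u <_) (sym (count≡countᵇ P?))
    (countᵇ-< (λ v → proj₁ ∘ to (T-∧ {does (P? v)})) u (¬u<u u) (from (T-does (P? u)) Pu))

  rank-< : ∀ {u v} → P u → toℕ u < toℕ v → rank u < rank v
  rank-< {u} {v} Pu u<v = countᵇ-< before-u⊆before-v u (¬u<u u) (from T-∧ (from (T-does (P? u)) Pu , <⇒<ᵇ u<v))
    where
      before-u⊆before-v : ∀ x → T (does (P? x) ∧ (toℕ x <ᵇ toℕ u)) → T (does (P? x) ∧ (toℕ x <ᵇ toℕ v))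
      before-u⊆before-v x h = let Px , x<u = to (T-∧ {does (P? x)}) h in
        from T-∧ (Px , <⇒<ᵇ (<-trans (<ᵇ⇒< (toℕ x) (toℕ u) x<u) u<v))

  rank-injective : ∀ {u v} → P u → P v → rank u ≡ rank v → u ≡ v
  rank-injective {u} {v} Pu Pv eq with <-cmp (toℕ u) (toℕ v)
  ... | tri< u<v _ _ = ⊥-elim (<-irrefl eq (rank-< Pu u<v))
  ... | tri≈ _ u≡v _ = toℕ-injective u≡v
  ... | tri> _ _ v<u = ⊥-elim (<-irrefl (sym eq) (rank-< Pv v<u))

  indexIn : ∀ {u} → .(P u) → Fin (count P?)
  indexIn Pu = fromℕ< (rank<count Pu)

  indexIn-injective : ∀ {u v} (Pu : P u) (Pv : P v) → indexIn Pu ≡ indexIn Pv → u ≡ v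
  indexIn-injective Pu Pv eq = rank-injective Pu Pv (fromℕ<-injective _ _ _ _ eq)

n≤n^2 : ∀ n → n ≤ n ^ 2
n≤n^2 zero    = ≤-refl
n≤n^2 (suc n) = m≤m*n (suc n) (suc n ^ 1)

transpose-fst : ∀ {n} (p q : Fin n) → Perm.transpose p q p ≡ q
transpose-fst p q rewrite dec-true (p ≟ p) refl = refl

transpose-injective : ∀ {n} (p q : Fin n) {x y} → Perm.transpose p q x ≡ Perm.transpose p q y → x ≡ y
transpose-injective p q {x} {y} eq = begin
  x                                                 ≡⟨ Perm.transpose-inverse q p ⟨
  Perm.transpose q p (Perm.transpose p q x)        ≡⟨ cong (Perm.transpose q p) eq ⟩
  Perm.transpose q p (Perm.transpose p q y)        ≡⟨ Perm.transpose-inverse q p ⟩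
  y                                                 ∎
  where open ≡-Reasoning

module Merge {r} (a b : Fin (suc r)) (a≢b : a ≢ b) (i : Fin r) where

  squash : Fin (suc r) → Fin r
  squash x with b ≟ x
  ... | yes _   = punchOut (≢-sym a≢b)
  ... | no b≢x = punchOut b≢x

  squash-b : squash b ≡ squash a
  squash-b with b ≟ b | b ≟ a
  ... | yes _ | no _    = punchOut-cong b refl
  ... | yes _ | yes b≡a = ⊥-elim (a≢b (sym b≡a))
  ... | no b≢b | _      = ⊥-elim (b≢b refl)

  squash-injective : ∀ {x y} → b ≢ x → b ≢ y → squash x ≡ squash y → x ≡ y
  squash-injective {x} {y} b≢x b≢y eq with b ≟ x | b ≟ y
  ... | yes b≡x | _       = ⊥-elim (b≢x b≡x)
  ... | no _    | yes b≡y = ⊥-elim (b≢y b≡y)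
  ... | no b≢x′ | no b≢y′ = punchOut-injective b≢x′ b≢y′ eq

  merge : Fin (suc r) → Fin r
  merge = Perm.transpose (squash a) i ∘ squash

  merge-a : merge a ≡ i
  merge-a = transpose-fst (squash a) i

  merge-b : merge b ≡ i
  merge-b = trans (cong (Perm.transpose (squash a) i) squash-b) merge-a

  merge-injective : ∀ {x y} → x ≢ a → x ≢ b → x ≢ y → merge x ≢ merge y
  merge-injective {x} {y} x≢a x≢b x≢y = squash-separates (b ≟ y) ∘ transpose-injective (squash a) i
    where
      squash-separates : Dec (b ≡ y) → squash x ≢ squash y
      squash-separates (yes b≡y) eq = x≢a (squash-injective (≢-sym x≢b) (≢-sym a≢b)
                                        (trans eq (trans (cong squash (sym b≡y)) squash-b)))
      squash-separates (no b≢y)  eq = x≢y (squash-injective (≢-sym x≢b) b≢y eq)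

Edge-sym : ∀ {n} (G : Graph n) {u v} → Edge G u v → Edge G v u
Edge-sym G {u} {v} = subst T (Graph.sym G u v)

module _ (s t : ℕ) where

  sideOf-↑ˡ : ∀ x → sideOf s {t} (x ↑ˡ t) ≡ true
  sideOf-↑ˡ x rewrite splitAt-↑ˡ s x t = refl

  sideOf-↑ʳ : ∀ y → sideOf s {t} (s ↑ʳ y) ≡ false
  sideOf-↑ʳ y rewrite splitAt-↑ʳ s t y = refl

  K-edge : ∀ x y → Edge (K s t) (x ↑ˡ t) (s ↑ʳ y)
  K-edge x y = subst T (sym (cong₂ _xor_ (sideOf-↑ˡ x) (sideOf-↑ʳ y))) _

  ↑ˡ≢↑ʳ : ∀ x y → x ↑ˡ t ≢ s ↑ʳ y
  ↑ˡ≢↑ʳ x y eq with trans (sym (sideOf-↑ˡ x)) (trans (cong (sideOf s) eq) (sideOf-↑ʳ y))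
  ... | ()

module Copies {m n r} (F : Graph m) (G : Graph n) (part : Fin n → Fin r) (target : Fin m → Fin r) where

  record PartialCopy (D : Pred (Fin m) 0ℓ) (ψ : Fin m → Fin n) : Set where
    field
      respects  : ∀ {u} → D u → part (ψ u) ≡ target u
      injective : ∀ {u v} → D u → D v → ψ u ≡ ψ v → u ≡ v
      preserves : ∀ {u v} → D u → D v → Edge F u v → Edge G (ψ u) (ψ v)

  restrict : ∀ {D D′ ψ} → D′ ⊆ D → PartialCopy D ψ → PartialCopy D′ ψ
  restrict D′⊆D copy = record
    { respects  = respects ∘ D′⊆D
    ; injective = λ u∈D′ v∈D′ → injective (D′⊆D u∈D′) (D′⊆D v∈D′)
    ; preserves = λ u∈D′ v∈D′ → preserves (D′⊆D u∈D′) (D′⊆D v∈D′)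
    }
    where open PartialCopy copy

  total⇒IsEmbedding : ∀ {D ψ} → (∀ u → D u) → PartialCopy D ψ → IsEmbedding F G ψ
  total⇒IsEmbedding all copy = injective (all _) (all _) , λ u v → preserves (all u) (all v)
    where open PartialCopy copy

  module Extension (large : ∀ j → m ^ 2 ≤ partSize part j)
                   (dense : ∀ i j → i ≢ j → ∀ v → part v ≡ i → nonNbrsIn G part v j * m ≤ partSize part j)
    where

    inPart : Fin r → Fin n → Bool
    inPart j y = does (part y ≟ j)

    partSize≡countᵇ : ∀ j → partSize part j ≡ countᵇ (inPart j)
    partSize≡countᵇ j = count≡countᵇ (λ y → part y ≟ j)

    partSize>0 : Fin m → ∀ j → 0 < countᵇ (inPart j)
    partSize>0 w j = begin
      1                       ≤⟨ s≤s z≤n ⟩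
      suc (toℕ w)             ≤⟨ toℕ<n w ⟩
      m                       ≤⟨ n≤n^2 m ⟩
      m ^ 2                   ≤⟨ large j ⟩
      partSize part j         ≡⟨ partSize≡countᵇ j ⟩
      countᵇ (inPart j)       ∎
      where open ≤-Reasoning

    conflicts : Fin r → Fin n → Fin n → Bool
    conflicts j z y = if does (part z ≟ j) then does (y ≟ z) else does (adj G z y ≟ᵇ false)

    fewConflicts : ∀ j z → countᵇ (λ y → inPart j y ∧ conflicts j z y) * m ≤ countᵇ (inPart j)
    fewConflicts j z with part z ≟ j
    ... | yes _ = begin
      countᵇ (λ y → inPart j y ∧ does (y ≟ z)) * m   ≤⟨ *-monoˡ-≤ m (countᵇ-mono (λ y → proj₂ ∘ to (T-∧ {inPart j y}))) ⟩
      countᵇ (λ y → does (y ≟ z)) * m                ≡⟨ cong (_* m) (countᵇ-≟ z) ⟩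
      1 * m                                          ≡⟨ *-identityˡ m ⟩
      m                                              ≤⟨ n≤n^2 m ⟩
      m ^ 2                                          ≤⟨ large j ⟩
      partSize part j                                ≡⟨ partSize≡countᵇ j ⟩
      countᵇ (inPart j)                              ∎
      where open ≤-Reasoning
    ... | no z∉j = begin
      countᵇ (λ y → inPart j y ∧ does (adj G z y ≟ᵇ false)) * m
        ≡⟨ cong (_* m) (count≡countᵇ (λ y → (part y ≟ j) ×-dec (adj G z y ≟ᵇ false))) ⟨
      nonNbrsIn G part z j * m                       ≤⟨ dense (part z) j z∉j z refl ⟩
      partSize part j                                ≡⟨ partSize≡countᵇ j ⟩
      countᵇ (inPart j)                              ∎
      where open ≤-Reasoning

    unconflicted-inside : ∀ {j z y} → ¬ T (conflicts j z y) → part z ≡ j → y ≢ z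
    unconflicted-inside {j} {z} {y} free z∈j with part z ≟ j
    ... | yes _   = free ∘ from (T-does (y ≟ z))
    ... | no z∉j = ⊥-elim (z∉j z∈j)

    unconflicted-outside : ∀ {j z y} → ¬ T (conflicts j z y) → part z ≢ j → Edge G z y
    unconflicted-outside {j} {z} {y} free z∉j with part z ≟ j
    ... | yes z∈j = ⊥-elim (z∉j z∈j)
    ... | no _ with adj G z y
    ...   | true  = _
    ...   | false = ⊥-elim (free _)

    module _ {D ψ} (copy : PartialCopy D ψ) (w : Fin m)
             (separated : ∀ {v} → D v → Edge F w v → target v ≢ target w) where
      open PartialCopy copy

      freeVertex : ∃ λ x → part x ≡ target w
                         × (∀ {v} → D v → v ≢ w → x ≢ ψ v)
                         × (∀ {v} → D v → v ≢ w → Edge F w v → Edge G x (ψ v))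
      freeVertex
        with uncoveredExcept (inPart (target w)) (λ u → conflicts (target w) (ψ u)) w
               (partSize>0 w (target w)) (λ u _ → fewConflicts (target w) (ψ u))
      ... | x , x∈w , x-free = x , x∈w′ , x-new , x-adjacent
        where
          x∈w′ : part x ≡ target w
          x∈w′ = to (T-does (part x ≟ target w)) x∈w

          x-new : ∀ {v} → D v → v ≢ w → x ≢ ψ v
          x-new {v} v∈D v≢w with part (ψ v) ≟ target w
          ... | yes ψv∈w = unconflicted-inside (x-free v v≢w) ψv∈w
          ... | no ψv∉w = λ x≡ψv → ψv∉w (trans (cong part (sym x≡ψv)) x∈w′)

          x-adjacent : ∀ {v} → D v → v ≢ w → Edge F w v → Edge G x (ψ v)
          x-adjacent v∈D v≢w wv = Edge-sym G (unconflicted-outside (x-free _ v≢w)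
            (separated v∈D wv ∘ trans (sym (respects v∈D))))

      extendAt : ∀ x → part x ≡ target w → (∀ {v} → D v → v ≢ w → x ≢ ψ v) →
        (∀ {v} → D v → v ≢ w → Edge F w v → Edge G x (ψ v)) →
        PartialCopy (｛ w ｝ ∪ D) (updateAt ψ w (const x))
      extendAt x x∈w x-new x-adjacent = record
        { respects = respects′ ; injective = injective′ ; preserves = preserves′ }
        where
          ψ′ : Fin m → Fin n
          ψ′ = updateAt ψ w (const x)

          ψ′-w : ψ′ w ≡ x
          ψ′-w = updateAt-updates w ψ

          ψ′-old : ∀ {u} → u ≢ w → ψ′ u ≡ ψ u
          ψ′-old u≢w = updateAt-minimal _ w ψ u≢w

          isNewOrOld : ∀ {u} → (｛ w ｝ ∪ D) u → w ≡ u ⊎ (D u × u ≢ w)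
          isNewOrOld {u} u∈ with u ≟ w | u∈
          ... | yes u≡w | _        = inj₁ (sym u≡w)
          ... | no u≢w  | inj₁ w≡u = ⊥-elim (u≢w (sym w≡u))
          ... | no u≢w  | inj₂ u∈D = inj₂ (u∈D , u≢w)

          respects′ : ∀ {u} → (｛ w ｝ ∪ D) u → part (ψ′ u) ≡ target u
          respects′ u∈ with isNewOrOld u∈
          ... | inj₁ refl          = trans (cong part ψ′-w) x∈w
          ... | inj₂ (u∈D , u≢w) = trans (cong part (ψ′-old u≢w)) (respects u∈D)

          injective′ : ∀ {u v} → (｛ w ｝ ∪ D) u → (｛ w ｝ ∪ D) v → ψ′ u ≡ ψ′ v → u ≡ v
          injective′ u∈ v∈ eq with isNewOrOld u∈ | isNewOrOld v∈
          ... | inj₁ refl          | inj₁ refl          = refl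
          ... | inj₁ refl          | inj₂ (v∈D , v≢w) = ⊥-elim (x-new v∈D v≢w (trans (sym ψ′-w) (trans eq (ψ′-old v≢w))))
          ... | inj₂ (u∈D , u≢w) | inj₁ refl          = ⊥-elim (x-new u∈D u≢w (trans (sym ψ′-w) (trans (sym eq) (ψ′-old u≢w))))
          ... | inj₂ (u∈D , u≢w) | inj₂ (v∈D , v≢w) = injective u∈D v∈D (trans (sym (ψ′-old u≢w)) (trans eq (ψ′-old v≢w)))

          preserves′ : ∀ {u v} → (｛ w ｝ ∪ D) u → (｛ w ｝ ∪ D) v → Edge F u v → Edge G (ψ′ u) (ψ′ v)
          preserves′ u∈ v∈ uv with isNewOrOld u∈ | isNewOrOld v∈
          ... | inj₁ refl          | inj₁ refl          = ⊥-elim (subst T (Graph.irrefl F w) uv)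
          ... | inj₁ refl          | inj₂ (v∈D , v≢w) =
            subst₂ (Edge G) (sym ψ′-w) (sym (ψ′-old v≢w)) (x-adjacent v∈D v≢w uv)
          ... | inj₂ (u∈D , u≢w) | inj₁ refl          =
            subst₂ (Edge G) (sym (ψ′-old u≢w)) (sym ψ′-w) (Edge-sym G (x-adjacent u∈D u≢w (Edge-sym F uv)))
          ... | inj₂ (u∈D , u≢w) | inj₂ (v∈D , v≢w) =
            subst₂ (Edge G) (sym (ψ′-old u≢w)) (sym (ψ′-old v≢w)) (preserves u∈D v∈D uv)

      extend : ∃ λ ψ′ → PartialCopy (｛ w ｝ ∪ D) ψ′
      extend = let x , x∈w , x-new , x-adjacent = freeVertex in _ , extendAt x x∈w x-new x-adjacent

module Construction {r m n} (F : Graph m) (G : Graph n)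
  (c : Fin m → Fin (suc r)) (proper : IsProperColoring F (suc r) c)
  {a b : Fin (suc r)} (a≢b : a ≢ b) (part : Fin n → Fin r)
  (large : ∀ j → m ^ 2 ≤ partSize part j)
  (dense : ∀ i j → i ≢ j → ∀ v → part v ≡ i → nonNbrsIn G part v j * m ≤ partSize part j)
  {i : Fin r} (φ : Fin (classSize c a + classSize c b) → Fin n)
  (φ-embedding : IsEmbedding (K (classSize c a) (classSize c b)) G φ) (φ-part : ∀ x → part (φ x) ≡ i)
  where

  open Merge a b a≢b i
  open Copies F G part (merge ∘ c)
  open Extension large dense

  private
    s t : ℕ
    s = classSize c a
    t = classSize c b

    φ-injective : ∀ {x y} → φ x ≡ φ y → x ≡ y
    φ-injective = proj₁ φ-embedding

    φ-edge : ∀ x y → Edge (K s t) x y → Edge G (φ x) (φ y)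
    φ-edge = proj₂ φ-embedding

  ColourClass : Fin (suc r) → Pred (Fin m) 0ℓ
  ColourClass col u = c u ≡ col

  indexInClass : ∀ col {u} → .(c u ≡ col) → Fin (classSize c col)
  indexInClass col = indexIn (λ v → c v ≟ col)

  placeBy : ∀ u → Dec (c u ≡ a) → Dec (c u ≡ b) → Fin n
  placeBy u (yes u∈a) _         = φ (indexInClass a u∈a ↑ˡ t)
  placeBy u (no _)    (yes u∈b) = φ (s ↑ʳ indexInClass b u∈b)
  placeBy u (no _)    (no _)    = proj₁ (countᵇ>0⇒∃ (inPart i) (partSize>0 u i))   -- arbitrary: u is placed later

  placeOnK : Fin m → Fin n
  placeOnK u = placeBy u (c u ≟ a) (c u ≟ b)

  placeOnK-a : ∀ {u} (u∈a : c u ≡ a) → placeOnK u ≡ φ (indexInClass a u∈a ↑ˡ t)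
  placeOnK-a {u} u∈a = placeBy-a (c u ≟ a) (c u ≟ b)
    where
      placeBy-a : ∀ da db → placeBy u da db ≡ φ (indexInClass a u∈a ↑ˡ t)
      placeBy-a (yes _)   _ = refl
      placeBy-a (no u∉a) _ = ⊥-elim (u∉a u∈a)

  placeOnK-b : ∀ {u} (u∈b : c u ≡ b) → placeOnK u ≡ φ (s ↑ʳ indexInClass b u∈b)
  placeOnK-b {u} u∈b = placeBy-b (c u ≟ a) (c u ≟ b)
    where
      placeBy-b : ∀ da db → placeBy u da db ≡ φ (s ↑ʳ indexInClass b u∈b)
      placeBy-b (yes u∈a) _        = ⊥-elim (a≢b (trans (sym u∈a) u∈b))
      placeBy-b (no _)    (yes _)   = refl
      placeBy-b (no _)    (no u∉b) = ⊥-elim (u∉b u∈b)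

  copyOnK : PartialCopy (ColourClass a ∪ ColourClass b) placeOnK
  copyOnK = record { respects = respects ; injective = injective ; preserves = preserves }
    where
      respects : ∀ {u} → (ColourClass a ∪ ColourClass b) u → part (placeOnK u) ≡ merge (c u)
      respects (inj₁ u∈a) = trans (cong part (placeOnK-a u∈a)) (trans (φ-part _) (sym (trans (cong merge u∈a) merge-a)))
      respects (inj₂ u∈b) = trans (cong part (placeOnK-b u∈b)) (trans (φ-part _) (sym (trans (cong merge u∈b) merge-b)))

      injective : ∀ {u v} → (ColourClass a ∪ ColourClass b) u → (ColourClass a ∪ ColourClass b) v →
        placeOnK u ≡ placeOnK v → u ≡ v
      injective (inj₁ u∈a) (inj₁ v∈a) eq = indexIn-injective (λ x → c x ≟ a) u∈a v∈a
        (↑ˡ-injective t _ _ (φ-injective (trans (sym (placeOnK-a u∈a)) (trans eq (placeOnK-a v∈a)))))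
      injective (inj₁ u∈a) (inj₂ v∈b) eq =
        ⊥-elim (↑ˡ≢↑ʳ s t _ _ (φ-injective (trans (sym (placeOnK-a u∈a)) (trans eq (placeOnK-b v∈b)))))
      injective (inj₂ u∈b) (inj₁ v∈a) eq =
        ⊥-elim (↑ˡ≢↑ʳ s t _ _ (φ-injective (trans (sym (placeOnK-a v∈a)) (trans (sym eq) (placeOnK-b u∈b)))))
      injective (inj₂ u∈b) (inj₂ v∈b) eq = indexIn-injective (λ x → c x ≟ b) u∈b v∈b
        (↑ʳ-injective s _ _ (φ-injective (trans (sym (placeOnK-b u∈b)) (trans eq (placeOnK-b v∈b)))))

      preserves : ∀ {u v} → (ColourClass a ∪ ColourClass b) u → (ColourClass a ∪ ColourClass b) v →
        Edge F u v → Edge G (placeOnK u) (placeOnK v)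
      preserves {u} {v} (inj₁ u∈a) (inj₁ v∈a) uv = ⊥-elim (proper u v uv (trans u∈a (sym v∈a)))
      preserves (inj₁ u∈a) (inj₂ v∈b) uv =
        subst₂ (Edge G) (sym (placeOnK-a u∈a)) (sym (placeOnK-b v∈b)) (φ-edge _ _ (K-edge s t _ _))
      preserves (inj₂ u∈b) (inj₁ v∈a) uv =
        subst₂ (Edge G) (sym (placeOnK-b u∈b)) (sym (placeOnK-a v∈a)) (Edge-sym G (φ-edge _ _ (K-edge s t _ _)))
      preserves {u} {v} (inj₂ u∈b) (inj₂ v∈b) uv = ⊥-elim (proper u v uv (trans u∈b (sym v∈b)))

  Placed : ℕ → Pred (Fin m) 0ℓ
  Placed k = (ColourClass a ∪ ColourClass b) ∪ (λ u → toℕ u < k)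

  grow : ∀ {k ψ} (k<m : k < m) → PartialCopy (Placed k) ψ → ∃ λ ψ′ → PartialCopy (Placed (suc k)) ψ′
  grow {k} k<m copy = let ψ′ , copy′ = placeNext in ψ′ , restrict nextPlaced copy′
    where
      w : Fin m
      w = fromℕ< k<m

      nextPlaced : Placed (suc k) ⊆ ｛ w ｝ ∪ Placed k
      nextPlaced (inj₁ u∈ab) = inj₂ (inj₁ u∈ab)
      nextPlaced (inj₂ (s≤s u≤k)) with m≤n⇒m<n∨m≡n u≤k
      ... | inj₁ u<k = inj₂ (inj₂ u<k)
      ... | inj₂ u≡k = inj₁ (toℕ-injective (trans (toℕ-fromℕ< k<m) (sym u≡k)))

      placeNext : ∃ λ ψ′ → PartialCopy (｛ w ｝ ∪ Placed k) ψ′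
      placeNext with c w ≟ a | c w ≟ b
      ... | yes w∈a | _       = _ , restrict [ (λ { refl → inj₁ (inj₁ w∈a) }) , id ] copy
      ... | no _    | yes w∈b = _ , restrict [ (λ { refl → inj₁ (inj₂ w∈b) }) , id ] copy
      ... | no w∉a  | no w∉b  = extend copy w λ {v} _ wv → ≢-sym (merge-injective w∉a w∉b (proper w v wv))

  placeAll : ∀ k → k ≤ m → ∃ λ ψ → PartialCopy (Placed k) ψ
  placeAll zero    _   = placeOnK , restrict [ id , (λ ()) ] copyOnK
  placeAll (suc k) k<m = let ψ , copy = placeAll k (<⇒≤ k<m) in grow k<m copy

  containsCopy : ContainsCopy F G
  containsCopy = let ψ , copyᵐ = placeAll m ≤-refl in ψ , total⇒IsEmbedding (λ u → inj₂ (toℕ<n u)) copyᵐ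

proposition2p4 : (r s t m n : ℕ) (F : Graph m) (G : Graph n) →
    (Σ (Fin m → Fin (suc r)) λ c → IsProperColoring F (suc r) c ×
      Σ (Fin (suc r)) λ a → Σ (Fin (suc r)) λ b →
        a ≢ b × classSize c a ≡ s × classSize c b ≡ t) →
    (part : Fin n → Fin r) →
    (∀ i → m ^ 2 ≤ partSize part i) →
    (∀ i j → i ≢ j → ∀ v → part v ≡ i → nonNbrsIn G part v j * m ≤ partSize part j) →
    (Σ (Fin r) λ i → InducedPartContainsCopy (K s t) G part i) →
    ContainsCopy F G
proposition2p4 r ._ ._ m n F G (c , proper , a , b , a≢b , refl , refl) part large dense (i , φ , φ-embedding , φ-part) =
  Construction.containsCopy F G c proper a≢b part large dense φ φ-embedding φ-part
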